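{- Let $\mathcal M_1=(W_1,\preccurlyeq_1,S_1,V_1)$ and $\mathcal M_2=(W_2,\preccurlyeq_2,S_2,V_2)$ be models and $\mathcal Z_n\subseteq\cdots\subseteq\mathcal Z_0$ a bounded $\mathcal U$-bisimulation between them. Then for all $m\le n$ and $(w_1,w_2)\in W_1\times W_2$, if $w_1\mathcal Z_mw_2$, then for every $\varphi\in\mathcal L_{\mathcal U}$ with $|\varphi|\le m$, $\mathcal M_1,w_1\models\varphi$ iff $\mathcal M_2,w_2\models\varphi$.
   Context: A model is $(W,\preccurlyeq,S,V)$ with $\preccurlyeq$ a partial order on $W\ne\emptyset$, $S:W\to W$ satisfying $w\preccurlyeq v\Rightarrow S(w)\preccurlyeq S(v)$, and $V$ assigning each world a set of propositional variables, monotone along $\preccurlyeq$. $\mathcal L_{\mathcal U}$ is the set of formulas built from variables and $\bot$ using $\wedge,\vee,\to,\bigcirc,\mathcal U$. Satisfaction: $w\models p$ iff $p\in V(w)$; $w\not\models\bot$; $\wedge,\vee$ classical; $w\models\varphi\to\psi$ iff for all $v\succcurlyeq w$, $v\models\varphi$ implies $v\models\psi$; $w\models\bigcirc\varphi$ iff $S(w)\models\varphi$; $w\models\varphi\,\mathcal U\,\psi$ iff there is $k\ge0$ with $S^k(w)\models\psi$ and $S^i(w)\models\varphi$ for all $i\in[0,k)$. Length: $|p|=|\bot|=0$; $|\varphi\odot\psi|=1+|\varphi|+|\psi|$ for binary $\odot$; $|\odot\psi|=1+|\psi|$ for unary $\odot$. For $n>0$, a bounded $\bigcirc$-bisimulation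 is a sequence $\mathcal Z_n\subseteq\cdots\subseteq\mathcal Z_0\subseteq W_1\times W_2$ such that for all $0\le i<n$: if $w_1\mathcal Z_iw_2$ then $w_1,w_2$ satisfy the same variables; if $w_1\mathcal Z_{i+1}w_2$ then every $v_1\succcurlyeq w_1$ has some $v_2\succcurlyeq w_2$ with $v_1\mathcal Z_iv_2$, every $v_2\succcurlyeq w_2$ has some $v_1\succcurlyeq w_1$ with $v_1\mathcal Z_iv_2$, and $S_1(w_1)\mathcal Z_iS_2(w_2)$. It is a bounded $\mathcal U$-bisimulation if moreover, for all $0\le i<n$ and $w_1\mathcal Z_{i+1}w_2$: (Forth $\mathcal U$) for every $k_1\ge0$ there are $k_2\ge0$ and $(v_1,v_2)\in W_1\times W_2$ with $S_2^{k_2}(w_2)\succcurlyeq v_2$, $v_1\succcurlyeq S_1^{k_1}(w_1)$, $v_1\mathcal Z_iv_2$, and such that for every $j_2\in[0,k_2)$ there are $j_1\in[0,k_1)$ and $(u_1,u_2)$ with $u_1\succcurlyeq S_1^{j_1}(w_1)$, $S_2^{j_2}(w_2)\succcurlyeq u_2$, $u_1\mathcal Z_iu_2$; (Back $\mathcal U$) for every $k_2\ge0$ there are $k_1\ge0$ and $(v_1,v_2)$ with $S_1^{k_1}(w_1)\succcurlyeq v_1$, $v_2\succcurlyeq S_2^{k_2}(w_2)$, $v_1\mathcal Z_iv_2$, and such that for every $j_1\in[0,k_1)$ there are $j_2\in[0,k_2)$ and $(u_1,u_2)$ with $u_2\succcurlyeq S_2^{j_2}(w_2)$, $S_1^{j_1}(w_1)\succcurlyeq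 u_1$, $u_1\mathcal Z_iu_2$. -}

module Defs where

open import Data.Nat using (ℕ; zero; suc; _+_; _≤_; _<_)
open import Data.Product using (Σ; _×_; _,_; ∃; ∃-syntax)
open import Data.Sum using (_⊎_)
open import Data.Empty using (⊥)
open import Relation.Binary.PropositionalEquality using (_≡_)
open import Relation.Binary.Structures using (IsPartialOrder)
open import Function.Bundles using (_⇔_)

iter : {A : Set} → (A → A) → ℕ → A → A
iter f zero    x = x
iter f (suc k) x = f (iter f k x)

Var : Set
Var = ℕ

record Model : Set₁ where
  field
    W        : Set
    inhabited : W
    _≼_      : W → W → Set
    ≼-po     : IsPartialOrder _≡_ _≼_
    S        : W → W
    S-mono   : ∀ {w v} → w ≼ v → S w ≼ S v
    V        : W → Var → Set
    V-mono   : ∀ {w v} p → w ≼ v → V w p → V v p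

data Form : Set where
  var  : Var → Form
  ⊥'   : Form
  _∧'_ : Form → Form → Form
  _∨'_ : Form → Form → Form
  _⇒'_ : Form → Form → Form
  ○_   : Form → Form
  _𝒰_  : Form → Form → Form

∣_∣ : Form → ℕ
∣ var p ∣   = 0
∣ ⊥' ∣      = 0
∣ φ ∧' ψ ∣  = suc (∣ φ ∣ + ∣ ψ ∣)
∣ φ ∨' ψ ∣  = suc (∣ φ ∣ + ∣ ψ ∣)
∣ φ ⇒' ψ ∣  = suc (∣ φ ∣ + ∣ ψ ∣)
∣ ○ φ ∣     = suc ∣ φ ∣
∣ φ 𝒰 ψ ∣   = suc (∣ φ ∣ + ∣ ψ ∣)

module _ (M : Model) where
  open Model M

  Sat : W → Form → Set
  Sat w (var p)  = V w p
  Sat w ⊥'       = ⊥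
  Sat w (φ ∧' ψ) = Sat w φ × Sat w ψ
  Sat w (φ ∨' ψ) = Sat w φ ⊎ Sat w ψ
  Sat w (φ ⇒' ψ) = ∀ v → w ≼ v → Sat v φ → Sat v ψ
  Sat w (○ φ)    = Sat (S w) φ
  Sat w (φ 𝒰 ψ)  = ∃[ k ] (Sat (iter S k w) ψ × (∀ i → i < k → Sat (iter S i w) φ))

module _ (M₁ M₂ : Model) where
  open Model M₁ renaming (W to W₁; _≼_ to _≼₁_; S to S₁; V to V₁)
  open Model M₂ renaming (W to W₂; _≼_ to _≼₂_; S to S₂; V to V₂)

  -- A sequence Z_0, Z_1, ... of relations; only indices ≤ n are relevant.
  Rels : Set₁
  Rels = ℕ → W₁ → W₂ → Set

  record IsBoundedBisim (n : ℕ) (Z : Rels) : Set where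
    field
      nested : ∀ i → i < n → ∀ {w₁ w₂} → Z (suc i) w₁ w₂ → Z i w₁ w₂
      atoms  : ∀ i → i < n → ∀ {w₁ w₂} → Z i w₁ w₂ → ∀ p → (V₁ w₁ p ⇔ V₂ w₂ p)
      forth≼ : ∀ i → i < n → ∀ {w₁ w₂} → Z (suc i) w₁ w₂ →
               ∀ v₁ → w₁ ≼₁ v₁ → ∃[ v₂ ] (w₂ ≼₂ v₂ × Z i v₁ v₂)
      back≼  : ∀ i → i < n → ∀ {w₁ w₂} → Z (suc i) w₁ w₂ →
               ∀ v₂ → w₂ ≼₂ v₂ → ∃[ v₁ ] (w₁ ≼₁ v₁ × Z i v₁ v₂)
      next   : ∀ i → i < n → ∀ {w₁ w₂} → Z (suc i) w₁ w₂ → Z i (S₁ w₁) (S₂ w₂)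

  record IsBoundedUBisim (n : ℕ) (Z : Rels) : Set where
    field
      isBoundedBisim : IsBoundedBisim n Z
      forth𝒰 : ∀ i → i < n → ∀ {w₁ w₂} → Z (suc i) w₁ w₂ →
        ∀ k₁ → ∃[ k₂ ] Σ W₁ λ v₁ → Σ W₂ λ v₂ →
          (v₂ ≼₂ iter S₂ k₂ w₂) × (iter S₁ k₁ w₁ ≼₁ v₁) × Z i v₁ v₂ ×
          (∀ j₂ → j₂ < k₂ → ∃[ j₁ ] (j₁ < k₁ × Σ W₁ λ u₁ → Σ W₂ λ u₂ →
             (iter S₁ j₁ w₁ ≼₁ u₁) × (u₂ ≼₂ iter S₂ j₂ w₂) × Z i u₁ u₂))
      back𝒰 : ∀ i → i < n → ∀ {w₁ w₂} → Z (suc i) w₁ w₂ →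
        ∀ k₂ → ∃[ k₁ ] Σ W₁ λ v₁ → Σ W₂ λ v₂ →
          (v₁ ≼₁ iter S₁ k₁ w₁) × (iter S₂ k₂ w₂ ≼₂ v₂) × Z i v₁ v₂ ×
          (∀ j₁ → j₁ < k₁ → ∃[ j₂ ] (j₂ < k₂ × Σ W₁ λ u₁ → Σ W₂ λ u₂ →
             (iter S₂ j₂ w₂ ≼₂ u₂) × (u₁ ≼₁ iter S₁ j₁ w₁) × Z i u₁ u₂))

module Submission where

-- A compound formula of length ≤ 1 + j has immediate
-- subformulas of length ≤ j, and the clauses of the bisimulation at level
-- j + 1 reduce the claim to agreement on those subformulas along Z_j.
--
-- Each "back" clause
--     of the bisimulation is the "forth" clause of the converse relation
--     between the swapped models, so each lemma is used twice.
--   * The induction itself, with the main theorem as a direct corollary.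

open import Defs
open import Data.Nat using (ℕ; zero; suc; _+_; _≤_; _<_; _≤′_; ≤′-refl; ≤′-step; s≤s)
open import Data.Nat.Properties using (<⇒≤; z≤′n; m+n≤o⇒m≤o; m+n≤o⇒n≤o)
open import Data.Product using (Σ; _×_; _,_; ∃-syntax)
open import Data.Product.Function.NonDependent.Propositional using (_×-⇔_)
open import Data.Sum using (inj₁; inj₂)
open import Data.Sum.Function.Propositional using (_⊎-⇔_)
open import Function using (flip)
open import Function.Bundles using (_⇔_; mk⇔; Equivalence)
open import Relation.Binary.Structures using (IsPartialOrder; IsPreorder)

module Persistence (M : Model) where
  open Model M

  ≼-trans : ∀ {a b c} → a ≼ b → b ≼ c → a ≼ c
  ≼-trans = IsPreorder.trans (IsPartialOrder.isPreorder ≼-po)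

  iter-mono : ∀ k {w v} → w ≼ v → iter S k w ≼ iter S k v
  iter-mono zero    w≼v = w≼v
  iter-mono (suc k) w≼v = S-mono (iter-mono k w≼v)

  persist : ∀ φ {w v} → w ≼ v → Sat M w φ → Sat M v φ
  persist (var p)  w≼v s        = V-mono p w≼v s
  persist ⊥'       w≼v ()
  persist (φ ∧' ψ) w≼v (a , b)  = persist φ w≼v a , persist ψ w≼v b
  persist (φ ∨' ψ) w≼v (inj₁ a) = inj₁ (persist φ w≼v a)
  persist (φ ∨' ψ) w≼v (inj₂ b) = inj₂ (persist ψ w≼v b)
  persist (φ ⇒' ψ) w≼v f u v≼u  = f u (≼-trans w≼v v≼u)
  persist (○ φ)    w≼v s        = persist φ (S-mono w≼v) s
  persist (φ 𝒰 ψ)  w≼v (k , now , before) =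
    k , persist ψ (iter-mono k w≼v) now , λ i i<k → persist φ (iter-mono i w≼v) (before i i<k)

open Persistence using (persist)

module OneWayTransfer (M₁ M₂ : Model) (R : Model.W M₁ → Model.W M₂ → Set) where
  open Model M₁ using () renaming (W to W₁; _≼_ to _≼₁_; S to S₁)
  open Model M₂ using () renaming (W to W₂; _≼_ to _≼₂_; S to S₂)

  Transfers : Form → Set
  Transfers φ = ∀ {u₁ u₂} → R u₁ u₂ → Sat M₁ u₁ φ → Sat M₂ u₂ φ

  BackZig : W₁ → W₂ → Set
  BackZig w₁ w₂ = ∀ v₂ → w₂ ≼₂ v₂ → ∃[ v₁ ] (w₁ ≼₁ v₁ × R v₁ v₂)

  Covered : W₁ → W₂ → ℕ → ℕ → Set
  Covered w₁ w₂ k₁ k₂ =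
    ∀ j₂ → j₂ < k₂ → ∃[ j₁ ] (j₁ < k₁ × Σ W₁ λ u₁ → Σ W₂ λ u₂ →
      (iter S₁ j₁ w₁ ≼₁ u₁) × (u₂ ≼₂ iter S₂ j₂ w₂) × R u₁ u₂)

  ForthUntil : W₁ → W₂ → Set
  ForthUntil w₁ w₂ =
    ∀ k₁ → ∃[ k₂ ] Σ W₁ λ v₁ → Σ W₂ λ v₂ →
      (v₂ ≼₂ iter S₂ k₂ w₂) × (iter S₁ k₁ w₁ ≼₁ v₁) × R v₁ v₂ × Covered w₁ w₂ k₁ k₂

  -- An implication true at w₁ is true at w₂: evaluate it at the matching
  -- ≼-successor of w₁, pulling φ back to M₁ and pushing ψ forward to M₂.
  imp-transfer : ∀ φ ψ {w₁ w₂} → BackZig w₁ w₂ →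
    (∀ {u₁ u₂} → R u₁ u₂ → Sat M₂ u₂ φ → Sat M₁ u₁ φ) → Transfers ψ →
    Sat M₁ w₁ (φ ⇒' ψ) → Sat M₂ w₂ (φ ⇒' ψ)
  imp-transfer φ ψ zig φ← ψ→ f v₂ w₂≼v₂ φ-at-v₂ =
    let (v₁ , w₁≼v₁ , r) = zig v₂ w₂≼v₂
    in ψ→ r (f v₁ w₁≼v₁ (φ← r φ-at-v₂))

  transfer-between : ∀ φ {w₁ w₂ u₁ u₂} → Transfers φ →
    w₁ ≼₁ u₁ → u₂ ≼₂ w₂ → R u₁ u₂ → Sat M₁ w₁ φ → Sat M₂ w₂ φ
  transfer-between φ φ→ w₁≼u₁ u₂≼w₂ r s =
    persist M₂ φ u₂≼w₂ (φ→ r (persist M₁ φ w₁≼u₁ s))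

  covered-transfer : ∀ φ {w₁ w₂ k₁ k₂} → Transfers φ → Covered w₁ w₂ k₁ k₂ →
    (∀ j₁ → j₁ < k₁ → Sat M₁ (iter S₁ j₁ w₁) φ) →
    (∀ j₂ → j₂ < k₂ → Sat M₂ (iter S₂ j₂ w₂) φ)
  covered-transfer φ φ→ covered φ-before-k₁ j₂ j₂<k₂ =
    let (j₁ , j₁<k₁ , u₁ , u₂ , ≼u₁ , u₂≼ , r) = covered j₂ j₂<k₂
    in transfer-between φ φ→ ≼u₁ u₂≼ r (φ-before-k₁ j₁ j₁<k₁)

  until-transfer : ∀ φ ψ {w₁ w₂} → ForthUntil w₁ w₂ → Transfers φ → Transfers ψ →
    Sat M₁ w₁ (φ 𝒰 ψ) → Sat M₂ w₂ (φ 𝒰 ψ)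
  until-transfer φ ψ forth φ→ ψ→ (k₁ , ψ-at-k₁ , φ-before-k₁) =
    let (k₂ , v₁ , v₂ , v₂≼ , ≼v₁ , r , covered) = forth k₁
    in k₂ , transfer-between ψ ψ→ ≼v₁ v₂≼ r ψ-at-k₁
          , covered-transfer φ φ→ covered φ-before-k₁

open OneWayTransfer using (Transfers; imp-transfer; until-transfer)

module _ (M₁ M₂ : Model) (n : ℕ) (0<n : 0 < n) (Z : Rels M₁ M₂)
         (bisim : IsBoundedUBisim M₁ M₂ n Z) where
  open IsBoundedUBisim bisim
  open IsBoundedBisim isBoundedBisim

  Z-antitone : ∀ {i j} → i ≤′ j → j ≤ n → ∀ {w₁ w₂} → Z j w₁ w₂ → Z i w₁ w₂
  Z-antitone ≤′-refl        _    z = z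
  Z-antitone (≤′-step i≤′j) sj≤n z = Z-antitone i≤′j (<⇒≤ sj≤n) (nested _ sj≤n z)

  back𝒰-as-forth : ∀ i → i < n → ∀ {w₁ w₂} → Z (suc i) w₁ w₂ →
    OneWayTransfer.ForthUntil M₂ M₁ (flip (Z i)) w₂ w₁
  back𝒰-as-forth i i<n z k₂ =
    let (k₁ , v₁ , v₂ , v₁≼ , ≼v₂ , r , earlier) = back𝒰 i i<n z k₂
    in k₁ , v₂ , v₁ , v₁≼ , ≼v₂ , r , λ j₁ j₁<k₁ →
         let (j₂ , j₂<k₂ , u₁ , u₂ , ≼u₂ , u₁≼ , r′) = earlier j₁ j₁<k₁
         in j₂ , j₂<k₂ , u₂ , u₁ , ≼u₂ , u₁≼ , r′

  Agree : ℕ → Form → Set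
  Agree i φ = ∀ {w₁ w₂} → Z i w₁ w₂ → Sat M₁ w₁ φ ⇔ Sat M₂ w₂ φ

  forward : ∀ {i} φ → Agree i φ → Transfers M₁ M₂ (Z i) φ
  forward φ agree z = Equivalence.to (agree z)

  backward : ∀ {i} φ → Agree i φ → Transfers M₂ M₁ (flip (Z i)) φ
  backward φ agree z = Equivalence.from (agree z)

  agree : ∀ φ {i} → i ≤ n → ∣ φ ∣ ≤ i → Agree i φ

  halves-agree : ∀ φ ψ {j} → j < n → ∣ φ ∣ + ∣ ψ ∣ ≤ j → Agree j φ × Agree j ψ
  halves-agree φ ψ j<n size =
    agree φ (<⇒≤ j<n) (m+n≤o⇒m≤o ∣ φ ∣ size) , agree ψ (<⇒≤ j<n) (m+n≤o⇒n≤o ∣ φ ∣ size)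

  agree (var p)  i≤n _ z = atoms 0 0<n (Z-antitone z≤′n i≤n z) p
  agree ⊥'       _   _ _ = mk⇔ (λ ()) (λ ())
  agree (○ φ)    {suc j} j<n (s≤s ∣φ∣≤j) z = agree φ (<⇒≤ j<n) ∣φ∣≤j (next j j<n z)
  agree (φ ∧' ψ) {suc j} j<n (s≤s size) z =
    let (agreeφ , agreeψ) = halves-agree φ ψ j<n size
    in agreeφ (nested j j<n z) ×-⇔ agreeψ (nested j j<n z)
  agree (φ ∨' ψ) {suc j} j<n (s≤s size) z =
    let (agreeφ , agreeψ) = halves-agree φ ψ j<n size
    in agreeφ (nested j j<n z) ⊎-⇔ agreeψ (nested j j<n z)
  agree (φ ⇒' ψ) {suc j} j<n (s≤s size) z =
    let (agreeφ , agreeψ) = halves-agree φ ψ j<n size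
    in mk⇔ (imp-transfer M₁ M₂ (Z j) φ ψ (back≼ j j<n z)
                         (backward φ agreeφ) (forward ψ agreeψ))
           (imp-transfer M₂ M₁ (flip (Z j)) φ ψ (forth≼ j j<n z)
                         (forward φ agreeφ) (backward ψ agreeψ))
  agree (φ 𝒰 ψ)  {suc j} j<n (s≤s size) z =
    let (agreeφ , agreeψ) = halves-agree φ ψ j<n size
    in mk⇔ (until-transfer M₁ M₂ (Z j) φ ψ (forth𝒰 j j<n z)
                           (forward φ agreeφ) (forward ψ agreeψ))
           (until-transfer M₂ M₁ (flip (Z j)) φ ψ (back𝒰-as-forth j j<n z)
                           (backward φ agreeφ) (backward ψ agreeψ))

mainTheorem14 : (M₁ M₂ : Model) (n : ℕ) → 0 < n → (Z : Rels M₁ M₂) →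
    IsBoundedUBisim M₁ M₂ n Z →
    ∀ m → m ≤ n → (w₁ : Model.W M₁) (w₂ : Model.W M₂) → Z m w₁ w₂ →
    (φ : Form) → ∣ φ ∣ ≤ m → (Sat M₁ w₁ φ ⇔ Sat M₂ w₂ φ)
mainTheorem14 M₁ M₂ n 0<n Z bisim m m≤n w₁ w₂ z φ ∣φ∣≤m =
  agree M₁ M₂ n 0<n Z bisim φ m≤n ∣φ∣≤m z
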